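{- For all finite lists $\Delta_1,\Delta_2$ of propositional variables and every finite list $\Gamma$ of pairs (natural number, modal tree): $\langle\Delta_1\frown\Delta_2;\Gamma\rangle\hookrightarrow^{*}\langle\Delta_2\frown\Delta_1;\Gamma\rangle$ and $\langle\Delta_2\frown\Delta_1;\Gamma\rangle\hookrightarrow^{*}\langle\Delta_1\frown\Delta_2;\Gamma\rangle$.
   Context: Modal trees: recursively, pairs $\langle\Delta;\Gamma\rangle$ with $\Delta$ a finite list of propositional variables and $\Gamma$ a finite list of pairs $(\alpha,\mathtt{S})$, $\alpha<\omega$, $\mathtt{S}$ a modal tree. Positions: $\mathrm{Pos}(\langle\Delta;\varnothing\rangle)=\{\epsilon\}$; $\mathrm{Pos}(\langle\Delta;[(\alpha_1,\mathtt{S}_1),\dots,(\alpha_n,\mathtt{S}_n)]\rangle)=\{\epsilon\}\cup\bigcup_{i=1}^n\{i\mathbf{k}\mid\mathbf{k}\in\mathrm{Pos}(\mathtt{S}_i)\}$. Subtree: $\mathtt{T}|_\epsilon=\mathtt{T}$, $\mathtt{T}|_{i\mathbf{r}}=\mathtt{S}_i|_{\mathbf{r}}$. Replacement: $\mathtt{T}[\mathtt{S}]_\epsilon=\mathtt{S}$, $\mathtt{T}[\mathtt{S}]_{i\mathbf{r}}$ is $\mathtt{T}$ with its $i$-th child $\mathtt{S}_i$ replaced by $\mathtt{S}_i[\mathtt{S}]_{\mathbf{r}}$ (same edge label). List operations, for $0<i,j\le|\Gamma|$: $\#_i\Gamma$ is the $i$-th element; $\Gamma^{ -i}$ deletes it;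 $\Gamma^{+i}=(\#_i\Gamma)\frown\Gamma$; $\Gamma[x]_i$ replaces the $i$-th element by $x$; $\Gamma^{i\leftrightarrow j}$ swaps the $i$-th and $j$-th elements; similarly $\Delta^{ -n},\Delta^{+n}$. $\mathsf{TRC}$ rules: for a modal tree $\mathtt{T}$, $\mathbf{k}\in\mathrm{Pos}(\mathtt{T})$ with $\mathtt{T}|_\mathbf{k}=\langle\Delta;\Gamma\rangle$: ($\rho^+$) $\mathtt{T}\hookrightarrow\mathtt{T}[\langle\Delta^{+i};\Gamma\rangle]_\mathbf{k}$, $0<i\le|\Delta|$; ($\rho^-$) $\mathtt{T}\hookrightarrow\mathtt{T}[\langle\Delta^{ -i};\Gamma\rangle]_\mathbf{k}$; ($\sigma$) $\mathtt{T}\hookrightarrow\mathtt{T}[\langle\Delta;\Gamma^{i\leftrightarrow j}\rangle]_\mathbf{k}$, $i\neq j$; ($\pi^+$) $\mathtt{T}\hookrightarrow\mathtt{T}[\langle\Delta;\Gamma^{+i}\rangle]_\mathbf{k}$; ($\pi^-$) $\mathtt{T}\hookrightarrow\mathtt{T}[\langle\Delta;\Gamma^{ -i}\rangle]_\mathbf{k}$; ($\mathfrak{4}$) if $\#_i\Gamma=(\beta,\langle\tilde\Delta;\tilde\Gamma\rangle)$ and $\#_j\tilde\Gamma=(\beta,\mathtt{S})$, then $\mathtt{T}\hookrightarrow\mathtt{T}[\langle\Delta;\Gamma[(\beta,\mathtt{S})]_i\rangle]_\mathbf{k}$; ($\lambda$) if $\#_i\Gamma=(\alpha,\mathtt{S})$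 and $\alpha>\beta$, then $\mathtt{T}\hookrightarrow\mathtt{T}[\langle\Delta;\Gamma[(\beta,\mathtt{S})]_i\rangle]_\mathbf{k}$; ($\mathsf{J}$) if $i\ne j$, $\#_i\Gamma=(\alpha,\langle\tilde\Delta;\tilde\Gamma\rangle)$, $\#_j\Gamma=(\beta,\mathtt{S})$, $\alpha>\beta$, then $\mathtt{T}\hookrightarrow\mathtt{T}[\langle\Delta;(\Gamma[(\alpha,\langle\tilde\Delta;\tilde\Gamma\frown(\beta,\mathtt{S})\rangle)]_i)^{ -j}\rangle]_\mathbf{k}$. $\hookrightarrow$ is the union of these relations, $\hookrightarrow^*$ its reflexive-transitive closure. -}

module Defs where

open import Data.Nat using (ℕ; _<_)
import Data.Nat as ℕ
open import Data.Product using (_×_; _,_; proj₁; proj₂)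
open import Data.List using (List; []; _∷_; _++_; length; tabulate)
open import Data.List.Base using (lookup; removeAt; updateAt)
open import Data.Fin using (Fin; zero; suc; cast)
open import Data.Fin.Permutation.Components using (transpose)
open import Relation.Binary.PropositionalEquality using (_≡_; refl; cong; sym)
open import Relation.Binary.Construct.Closure.ReflexiveTransitive using (Star)
open import Relation.Nullary using (¬_)

PropVar : Set
PropVar = ℕ

-- Modal trees ⟨Δ;Γ⟩ : Δ a list of propositional variables,
-- Γ a list of pairs (α , S) with α < ω and S a modal tree.
data ModalTree : Set where
  ⟨_⨾_⟩ : List PropVar → List (ℕ × ModalTree) → ModalTree

-- List operations.  An index i : Fin (length xs) stands for the paper's
-- 1-based index i+1, so the side condition 0 < i ≤ |xs| is built in.
-- #_i xs
nth : {A : Set} (xs : List A) → Fin (length xs) → A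
nth xs i = lookup xs i

del : {A : Set} (xs : List A) → Fin (length xs) → List A
del xs i = removeAt xs i

dup : {A : Set} (xs : List A) → Fin (length xs) → List A
dup xs i = lookup xs i ∷ xs

set : {A : Set} (xs : List A) → Fin (length xs) → A → List A
set (_ ∷ xs) zero    x = x ∷ xs
set (y ∷ xs) (suc i) x = y ∷ set xs i x

length-set : {A : Set} (xs : List A) (i : Fin (length xs)) (x : A) →
             length (set xs i x) ≡ length xs
length-set (_ ∷ xs) zero    x = refl
length-set (y ∷ xs) (suc i) x = cong ℕ.suc (length-set xs i x)

swp : {A : Set} (xs : List A) → Fin (length xs) → Fin (length xs) → List A
swp xs i j = tabulate (λ k → lookup xs (transpose i j k))

data _⟶ε_ : ModalTree → ModalTree → Set where
  ρ⁺ : ∀ {Δ Γ} (i : Fin (length Δ)) → ⟨ Δ ⨾ Γ ⟩ ⟶ε ⟨ dup Δ i ⨾ Γ ⟩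
  ρ⁻ : ∀ {Δ Γ} (i : Fin (length Δ)) → ⟨ Δ ⨾ Γ ⟩ ⟶ε ⟨ del Δ i ⨾ Γ ⟩
  σ  : ∀ {Δ Γ} (i j : Fin (length Γ)) → ¬ (i ≡ j) →
       ⟨ Δ ⨾ Γ ⟩ ⟶ε ⟨ Δ ⨾ swp Γ i j ⟩
  π⁺ : ∀ {Δ Γ} (i : Fin (length Γ)) → ⟨ Δ ⨾ Γ ⟩ ⟶ε ⟨ Δ ⨾ dup Γ i ⟩
  π⁻ : ∀ {Δ Γ} (i : Fin (length Γ)) → ⟨ Δ ⨾ Γ ⟩ ⟶ε ⟨ Δ ⨾ del Γ i ⟩
  r4 : ∀ {Δ Γ β Δ̃ Γ̃ S} (i : Fin (length Γ)) (j : Fin (length Γ̃)) →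
       nth Γ i ≡ (β , ⟨ Δ̃ ⨾ Γ̃ ⟩) → nth Γ̃ j ≡ (β , S) →
       ⟨ Δ ⨾ Γ ⟩ ⟶ε ⟨ Δ ⨾ set Γ i (β , S) ⟩
  λr : ∀ {Δ Γ α β S} (i : Fin (length Γ)) →
       nth Γ i ≡ (α , S) → β < α →
       ⟨ Δ ⨾ Γ ⟩ ⟶ε ⟨ Δ ⨾ set Γ i (β , S) ⟩
  J  : ∀ {Δ Γ α β Δ̃ Γ̃ S} (i j : Fin (length Γ)) → ¬ (i ≡ j) →
       nth Γ i ≡ (α , ⟨ Δ̃ ⨾ Γ̃ ⟩) → nth Γ j ≡ (β , S) → β < α →
       ⟨ Δ ⨾ Γ ⟩ ⟶ε
       ⟨ Δ ⨾ del (set Γ i (α , ⟨ Δ̃ ⨾ Γ̃ ++ (β , S) ∷ [] ⟩))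
                 (cast (sym (length-set Γ i _)) j) ⟩

-- Closure under positions: T ↪ T[S']_k whenever T|_k ⟶ε S'.
-- A step at position i·k (child i, then position k) rewrites only the
-- i-th child, keeping its edge label; this is exactly T[·]_{i k}.
data _↪_ : ModalTree → ModalTree → Set where
  at-ε    : ∀ {T T'} → T ⟶ε T' → T ↪ T'
  at-child : ∀ {Δ Γ} (i : Fin (length Γ)) {S'} →
             proj₂ (nth Γ i) ↪ S' →
             ⟨ Δ ⨾ Γ ⟩ ↪ ⟨ Δ ⨾ set Γ i (proj₁ (nth Γ i) , S') ⟩

_↪*_ : ModalTree → ModalTree → Set
_↪*_ = Star _↪_

{-# OPTIONS --safe #-}
module Submission where

-- The Δ-part of a node behaves like a set: ρ⁺ prepends a copy of any
-- variable already present and ρ⁻ deletes any variable.  So ⟨Δ ⨾ Γ⟩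
-- reaches ⟨Δ′ ⨾ Γ⟩ whenever Δ′ ⊆ Δ: prepend Δ′ variable by variable, then
-- delete the old Δ behind it.  Δ₁ ++ Δ₂ and Δ₂ ++ Δ₁ contain each other.

open import Defs
open import Data.Nat using (ℕ)
open import Data.Product using (_×_; _,_)
open import Data.List using (List; []; _∷_; _++_; length)
open import Data.List.Base using (removeAt)
open import Data.List.Properties using (++-identityʳ)
open import Data.List.Membership.Propositional using (_∈_)
open import Data.List.Membership.Propositional.Properties using (∈-++⁺ʳ)
open import Data.List.Relation.Unary.Any using (here; there; index)
open import Data.List.Relation.Unary.Any.Properties using (lookup-index)
open import Data.List.Relation.Binary.Subset.Propositional using (_⊆_)
open import Data.List.Relation.Binary.Subset.Propositional.Properties using (⊆-reflexive-↭)
open import Data.List.Relation.Binary.Permutation.Propositional.Properties using (++-comm)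
open import Data.Fin using (Fin; zero; suc)
open import Function using (_∘_)
open import Relation.Binary.PropositionalEquality using (_≡_; refl; sym; cong; subst)
open import Relation.Binary.Construct.Closure.ReflexiveTransitive using (ε; _◅_; _◅◅_)

middle : ∀ {A : Set} (N : List A) x L → Fin (length (N ++ x ∷ L))
middle []      x L = zero
middle (_ ∷ N) x L = suc (middle N x L)

removeAt-middle : ∀ {A : Set} (N : List A) x L → removeAt (N ++ x ∷ L) (middle N x L) ≡ N ++ L
removeAt-middle []      x L = refl
removeAt-middle (y ∷ N) x L = cong (y ∷_) (removeAt-middle N x L)

module _ {Γ : List (ℕ × ModalTree)} where

  ρ⁺-∈ : ∀ {x Δ} → x ∈ Δ → ⟨ Δ ⨾ Γ ⟩ ↪ ⟨ x ∷ Δ ⨾ Γ ⟩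
  ρ⁺-∈ {Δ = Δ} x∈Δ =
    subst (λ y → ⟨ Δ ⨾ Γ ⟩ ↪ ⟨ y ∷ Δ ⨾ Γ ⟩) (sym (lookup-index x∈Δ)) (at-ε (ρ⁺ (index x∈Δ)))

  ρ⁺-⊆ : ∀ {Δ} N → N ⊆ Δ → ⟨ Δ ⨾ Γ ⟩ ↪* ⟨ N ++ Δ ⨾ Γ ⟩
  ρ⁺-⊆ []      _   = ε
  ρ⁺-⊆ (x ∷ N) N⊆Δ = ρ⁺-⊆ N (N⊆Δ ∘ there) ◅◅ ρ⁺-∈ (∈-++⁺ʳ N (N⊆Δ (here refl))) ◅ ε

  ρ⁻-middle : ∀ N x L → ⟨ N ++ x ∷ L ⨾ Γ ⟩ ↪ ⟨ N ++ L ⨾ Γ ⟩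
  ρ⁻-middle N x L =
    subst (λ Δ → ⟨ N ++ x ∷ L ⨾ Γ ⟩ ↪ ⟨ Δ ⨾ Γ ⟩) (removeAt-middle N x L) (at-ε (ρ⁻ (middle N x L)))

  ρ⁻-suffix : ∀ N L → ⟨ N ++ L ⨾ Γ ⟩ ↪* ⟨ N ⨾ Γ ⟩
  ρ⁻-suffix N [] rewrite ++-identityʳ N = ε
  ρ⁻-suffix N (x ∷ L) = ρ⁻-middle N x L ◅ ρ⁻-suffix N L

  ⊆⇒↪* : ∀ {Δ Δ′} → Δ′ ⊆ Δ → ⟨ Δ ⨾ Γ ⟩ ↪* ⟨ Δ′ ⨾ Γ ⟩
  ⊆⇒↪* {Δ} {Δ′} Δ′⊆Δ = ρ⁺-⊆ Δ′ Δ′⊆Δ ◅◅ ρ⁻-suffix Δ′ Δ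

mainTheorem13 : (Δ₁ Δ₂ : List PropVar) (Γ : List (ℕ × ModalTree)) →
    (⟨ Δ₁ ++ Δ₂ ⨾ Γ ⟩ ↪* ⟨ Δ₂ ++ Δ₁ ⨾ Γ ⟩) × (⟨ Δ₂ ++ Δ₁ ⨾ Γ ⟩ ↪* ⟨ Δ₁ ++ Δ₂ ⨾ Γ ⟩)
mainTheorem13 Δ₁ Δ₂ Γ =
  ⊆⇒↪* (⊆-reflexive-↭ (++-comm Δ₂ Δ₁)) , ⊆⇒↪* (⊆-reflexive-↭ (++-comm Δ₁ Δ₂))
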